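{- Let $l$ be a complete distributive lattice, let $TS=(S,Act,\to,I,AP,L)$ be a (finite) multi-valued transition system over $l$ and let $P:(2^{AP})^{\omega}\to l$ be a safety property. Then $TS\models P$ if and only if $\mathrm{Traces}_{fin}(TS)\subseteq \mathrm{GPref}(P)$, i.e. $\mathrm{Traces}_{fin}(TS)(\theta)\le\mathrm{GPref}(P)(\theta)$ for all $\theta\in(2^{AP})^{*}$.
   Context: A multi-valued transition system (mv-TS) is $TS=(S,Act,\to,I,AP,L)$ with finite sets $S$ (states), $Act$ (actions), $AP$ (atomic propositions), a transition map $\eta:S\times Act\times S\to l$, an initial map $I:S\to l$ and a labeling $L:S\to 2^{AP}$. An infinite execution fragment is $\rho=s_0\alpha_1s_1\alpha_2\cdots$ with $s_i\in S,\alpha_i\in Act$; its truth value is $v(\rho)=I(s_0)\wedge\bigwedge_{i\ge0}\eta(s_i,\alpha_{i+1},s_{i+1})$. The trace function $\mathrm{Traces}(TS):(2^{AP})^{\omega}\to l$ is $\mathrm{Traces}(TS)(\sigma)=\bigvee\{v(\rho):\rho=s_0\alpha_1s_1\cdots \text{ with } L(s_0)L(s_1)\cdots=\sigma\}$ (empty join $=0$). The finite trace function is $\mathrm{Traces}_{fin}(TS)(\theta)=\bigvee\{\mathrm{Traces}(TS)(\theta\tau):\tau\in(2^{AP})^{\omega}\}$. For $P:(2^{AP})^{\omega}\to l$, $TS\models P$ means $\mathrm{Traces}(TS)(\sigma)\le P(\sigma)$ for all $\sigma$. $\mathrm{Pref}(\sigma)$ is the set of finite prefixes of $\sigma$; $\mathrm{GPref}(P)(\theta)=\bigvee\{P(\theta\tau):\tau\in(2^{AP})^{\omega}\}$;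 $P$ is a safety property if $\bigwedge\{\mathrm{GPref}(P)(\theta):\theta\in\mathrm{Pref}(\sigma)\}\le P(\sigma)$ for all $\sigma\in(2^{AP})^{\omega}$. -}

module Defs where

open import Level using (0ℓ)
open import Data.Nat using (ℕ; zero; suc)
open import Data.Bool using (Bool; true; false)
open import Data.Fin using (Fin)
open import Data.Fin.Subset using (Subset)
open import Data.List using (List; []; _∷_)
open import Data.Product using (Σ; Σ-syntax; _×_; _,_)
open import Relation.Binary.PropositionalEquality using (_≡_)
open import Relation.Binary.Bundles using (Poset)

-- Since the carrier lives in Set, every
-- subset of the carrier is such a family, so this is completeness.
pair : {A : Set} → A → A → Bool → A
pair x y true  = x
pair x y false = y

record CompleteDistributiveLattice : Set₁ where
  field
    poset : Poset 0ℓ 0ℓ 0ℓ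
  open Poset poset public
  field
    ⋁       : {I : Set} → (I → Carrier) → Carrier
    ⋁-upper : {I : Set} (f : I → Carrier) (i : I) → f i ≤ ⋁ f
    ⋁-least : {I : Set} (f : I → Carrier) (x : Carrier) → (∀ i → f i ≤ x) → ⋁ f ≤ x
    ⋀       : {I : Set} → (I → Carrier) → Carrier
    ⋀-lower : {I : Set} (f : I → Carrier) (i : I) → ⋀ f ≤ f i
    ⋀-great : {I : Set} (f : I → Carrier) (x : Carrier) → (∀ i → x ≤ f i) → x ≤ ⋀ f

  field
    distrib : ∀ x y z → ⋀ (pair x (⋁ (pair y z))) ≈ ⋁ (pair (⋀ (pair x y)) (⋀ (pair x z)))

  _∧_ : Carrier → Carrier → Carrier
  x ∧ y = ⋀ (pair x y)

  _∨_ : Carrier → Carrier → Carrier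
  x ∨ y = ⋁ (pair x y)

ω-Word : Set → Set
ω-Word A = ℕ → A

_++ω_ : {A : Set} → List A → ω-Word A → ω-Word A
([] ++ω τ) n           = τ n
((a ∷ θ) ++ω τ) zero    = a
((a ∷ θ) ++ω τ) (suc n) = (θ ++ω τ) n

_∈Pref_ : {A : Set} → List A → ω-Word A → Set
θ ∈Pref σ = Σ[ τ ∈ ω-Word _ ] (∀ i → (θ ++ω τ) i ≡ σ i)

module _ (l : CompleteDistributiveLattice) (nAP : ℕ) where
  open CompleteDistributiveLattice l

  Letter : Set
  Letter = Subset nAP

  record MVTS : Set where
    field
      nS   : ℕ
      nAct : ℕ
      η    : Fin nS → Fin nAct → Fin nS → Carrier
      I    : Fin nS → Carrier
      L    : Fin nS → Letter

  module _ (TS : MVTS) where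
    open MVTS TS

    -- infinite execution fragment s0 α1 s1 α2 ... ; act i = α_{i+1}
    record Execution : Set where
      constructor exec
      field
        st  : ℕ → Fin nS
        act : ℕ → Fin nAct

    value : Execution → Carrier
    value (exec s a) = I (s 0) ∧ ⋀ (λ i → η (s i) (a i) (s (suc i)))

    Traces : ω-Word Letter → Carrier
    Traces σ = ⋁ {Σ[ ρ ∈ Execution ] (∀ i → L (Execution.st ρ i) ≡ σ i)}
                 (λ p → value (Σ-proj p))
      where
      Σ-proj : Σ[ ρ ∈ Execution ] (∀ i → L (Execution.st ρ i) ≡ σ i) → Execution
      Σ-proj (ρ , _) = ρ

    Traces-fin : List Letter → Carrier
    Traces-fin θ = ⋁ (λ (τ : ω-Word Letter) → Traces (θ ++ω τ))

    _⊨_ : (ω-Word Letter → Carrier) → Set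
    _⊨_ P = ∀ σ → Traces σ ≤ P σ

  GPref : (ω-Word Letter → Carrier) → List Letter → Carrier
  GPref P θ = ⋁ (λ (τ : ω-Word Letter) → P (θ ++ω τ))

  IsSafety : (ω-Word Letter → Carrier) → Set
  IsSafety P = ∀ σ → ⋀ {Σ[ θ ∈ List Letter ] (θ ∈Pref σ)} (λ p → GPref P (fst p)) ≤ P σ
    where
    fst : {σ : ω-Word Letter} → Σ[ θ ∈ List Letter ] (θ ∈Pref σ) → List Letter
    fst (θ , _) = θ

-- Traces-fin and GPref are the joins of Traces and P over all continuations,
-- so TS ⊨ P gives Traces-fin ≤ GPref P without any assumption on P.
-- Conversely, Traces σ lies below Traces-fin θ ≤ GPref P θ for every prefix θ
-- of σ, hence below their meet, which safety bounds by P σ.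
module Submission where

open import Defs
open import Data.Nat using (ℕ)
open import Data.List using (List)
open import Data.Product using (_,_)
open import Function.Bundles using (_⇔_; mk⇔)
open import Relation.Binary.PropositionalEquality using (_≡_; trans; sym)
open CompleteDistributiveLattice using (_≤_)

module _ (l : CompleteDistributiveLattice) (nAP : ℕ) where
  open CompleteDistributiveLattice l
    using (Carrier; ⋁-upper; ⋁-least; ⋀-great)
    renaming (_≤_ to _⊑_; trans to ⊑-trans)

  P≤GPref : (P : ω-Word (Letter l nAP) → Carrier) (θ : List (Letter l nAP))
          (τ : ω-Word (Letter l nAP))
          → P (θ ++ω τ) ⊑ GPref l nAP P θ
  P≤GPref P θ = ⋁-upper (λ τ → P (θ ++ω τ))

  module _ (TS : MVTS l nAP) where

    Traces-mono-≗ : ∀ {σ σ′} → (∀ i → σ′ i ≡ σ i) → Traces l nAP TS σ ⊑ Traces l nAP TS σ′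
    Traces-mono-≗ σ′≗σ = ⋁-least _ _ λ { (ρ , ρ↦σ) →
      ⋁-upper _ (ρ , λ i → trans (ρ↦σ i) (sym (σ′≗σ i))) }

    Traces≤Traces-fin : ∀ θ {σ} → θ ∈Pref σ → Traces l nAP TS σ ⊑ Traces-fin l nAP TS θ
    Traces≤Traces-fin θ (τ , θτ≗σ) =
      ⊑-trans (Traces-mono-≗ θτ≗σ) (⋁-upper (λ τ′ → Traces l nAP TS (θ ++ω τ′)) τ)

    ⊨⇒Traces-fin≤GPref : ∀ P → _⊨_ l nAP TS P
                       → ∀ θ → Traces-fin l nAP TS θ ⊑ GPref l nAP P θ
    ⊨⇒Traces-fin≤GPref P TS⊨P θ =
      ⋁-least _ _ λ τ → ⊑-trans (TS⊨P (θ ++ω τ)) (P≤GPref P θ τ)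

    Traces-fin≤GPref⇒⊨ : ∀ P → IsSafety l nAP P
                       → (∀ θ → Traces-fin l nAP TS θ ⊑ GPref l nAP P θ)
                       → _⊨_ l nAP TS P
    Traces-fin≤GPref⇒⊨ P safe fin≤GPref σ = ⊑-trans
      (⋀-great _ _ λ { (θ , θ∈Pref) → ⊑-trans (Traces≤Traces-fin θ θ∈Pref) (fin≤GPref θ) })
      (safe σ)

theorem1 : (l : CompleteDistributiveLattice) (nAP : ℕ) (TS : MVTS l nAP)
    → (P : ω-Word (Letter l nAP) → CompleteDistributiveLattice.Carrier l)
    → IsSafety l nAP P
    → (_⊨_ l nAP TS P ⇔ (∀ (θ : List (Letter l nAP)) → _≤_ l (Traces-fin l nAP TS θ) (GPref l nAP P θ)))
theorem1 l nAP TS P safe =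
  mk⇔ (⊨⇒Traces-fin≤GPref l nAP TS P) (Traces-fin≤GPref⇒⊨ l nAP TS P safe)
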